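{- Let $S\neq\mathbb{N}$ be a numerical semigroup. Then $S^{(2)}=\widetilde{\widetilde{S}}$ is a numerical semigroup if and only if the numerical semigroup $S\cup\{n\in\mathbb{N}\mid n\ge B(S)\}$ is of maximal embedding dimension.
   Context: $\mathbb{N}=\{0,1,2,\dots\}$. A numerical set is a subset $S\subseteq\mathbb{N}$ with $0\in S$ and $\mathbb{N}\setminus S$ finite. Its gaps are the elements of $\mathbb{N}\setminus S$, and $F(S)$ is its largest gap. A numerical semigroup is a numerical set closed under addition. - $m(S)$ is the smallest positive element of $S$. - For $S\neq\mathbb{N}$, the base is $B(S)=\max\{s\in S\mid s<F(S)\}$. - An atom of a numerical semigroup $T$ is a positive element not expressible as a sum of two positive elements of $T$. - The embedding dimension $e(T)$ is the number of atoms. One always has $e(T)\le m(T)$, and $T$ is of maximal embedding dimension if $e(T)=m(T)$. Young diagram of $S$: it has one left-justified row for each gap $\ell$. The top row corresponds to $F(S)$, and the gaps decrease going down. The row for $\ell$ has length $|\{s\in S\mid s<\ell\}|$. This is a bijection between numerical sets and Young diagrams, with $\mathbb{N}$ corresponding to the empty diagram. The complement of a Young diagram with rows $\lambda_1\ge\dots\ge\lambda_g$ has rows $\lambda_1-\lambda_g\ge\dots\ge\lambda_1-\lambda_1$, zero rows being discarded. Geometrically, this is the rest of the $g\times\lambda_1$ rectangle rotated by $180^\circ$. The complement $\widetilde{S}$ is the numerical set whose Young diagram is the complement of that of $S$. One has $\widetilde{\mathbb{N}}=\mathbb{N}$, and for $S\neq\mathbb{N}$ equivalently $\widetilde{S}=\{B(S)-s\mid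 s\in S,\ s\le B(S)\}\cup\{n\mid n\ge B(S)\}$. -}

module Defs where

open import Data.Nat using (ℕ; zero; suc; _+_; _∸_; _≤_; _<_; _≤ᵇ_)
open import Data.Bool using (Bool; true; false; if_then_else_; _∨_; _∧_)
open import Data.Maybe using (Maybe; just; nothing; fromMaybe)
open import Data.Product using (_×_; ∃-syntax; Σ-syntax)
open import Data.List using (List; length)
open import Data.List.Membership.Propositional using (_∈_)
open import Data.List.Relation.Unary.Unique.Propositional using (Unique)
open import Relation.Binary.PropositionalEquality using (_≡_)
open import Relation.Nullary using (¬_)
open import Function.Bundles using (_⇔_)

-- A subset of ℕ given by a decidable membership function together with a
-- number `bound` beyond which (in a numerical set) every natural number is
-- a member.  `bound` is only a witness of cofiniteness; it need not be tight.
record CofSet : Set where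
  constructor mkCofSet
  field
    mem   : ℕ → Bool
    bound : ℕ
open CofSet public

infix 4 _∈ₛ_
_∈ₛ_ : ℕ → CofSet → Set
n ∈ₛ S = mem S n ≡ true

IsNumericalSet : CofSet → Set
IsNumericalSet S = (0 ∈ₛ S) × (∀ n → bound S ≤ n → n ∈ₛ S)

IsNumericalSemigroup : CofSet → Set
IsNumericalSemigroup S =
  IsNumericalSet S × (∀ a b → a ∈ₛ S → b ∈ₛ S → (a + b) ∈ₛ S)

IsAllℕ : CofSet → Set
IsAllℕ S = ∀ n → n ∈ₛ S

lastFalseBelow : (ℕ → Bool) → ℕ → Maybe ℕ
lastFalseBelow p zero = nothing
lastFalseBelow p (suc n) = if p n then lastFalseBelow p n else just n

lastTrueBelow : (ℕ → Bool) → ℕ → Maybe ℕ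
lastTrueBelow p zero = nothing
lastTrueBelow p (suc n) = if p n then just n else lastTrueBelow p n

frobenius : CofSet → Maybe ℕ
frobenius S = lastFalseBelow (mem S) (bound S)

-- base B(S) = max { s ∈ S | s < F(S) } (meaningful for S ≠ ℕ; default 0 otherwise)
baseAt : CofSet → ℕ → ℕ
baseAt S f = fromMaybe 0 (lastTrueBelow (mem S) f)

base : CofSet → ℕ
base S with frobenius S
... | nothing = 0
... | just f  = baseAt S f

complement : CofSet → CofSet
complement S with frobenius S
... | nothing = S
... | just f  = mkCofSet
        (λ n → (B ≤ᵇ n) ∨ ((n ≤ᵇ B) ∧ mem S (B ∸ n)))
        B
  where B = baseAt S f

secondComplement : CofSet → CofSet
secondComplement S = complement (complement S)

unionAboveBase : CofSet → CofSet
unionAboveBase S = mkCofSet (λ n → mem S n ∨ (base S ≤ᵇ n)) (bound S)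

IsMultiplicity : CofSet → ℕ → Set
IsMultiplicity T m = (0 < m) × (m ∈ₛ T) × (∀ k → 0 < k → k < m → ¬ (k ∈ₛ T))

IsAtom : CofSet → ℕ → Set
IsAtom T a = (0 < a) × (a ∈ₛ T) ×
  ¬ (∃[ x ] ∃[ y ] (0 < x) × (0 < y) × (x ∈ₛ T) × (y ∈ₛ T) × (x + y ≡ a))

HasEmbeddingDimension : CofSet → ℕ → Set
HasEmbeddingDimension T e =
  Σ[ as ∈ List ℕ ] Unique as × (∀ a → (a ∈ as) ⇔ IsAtom T a) × (length as ≡ e)

IsMaxEmbeddingDimension : CofSet → Set
IsMaxEmbeddingDimension T =
  ∃[ m ] IsMultiplicity T m × HasEmbeddingDimension T m

-- Let B be the base of S and T = S ∪ [B, ∞).  Complementing reflects S through B,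
-- and complementing again reflects through the base B′ of S̃; since 1 ∉ S, B − 1 is
-- a gap of S̃, so no element of S̃ lies strictly between B′ and B.  Hence B − B′ is
-- the multiplicity m of T and S⁽²⁾ = T − m = {n | n + m ∈ T}.  Thus S⁽²⁾ is closed
-- under addition iff x + y − m ∈ T for all positive x, y ∈ T, and this characterises
-- maximal embedding dimension: the least positive elements of the m residue classes
-- modulo m are then all atoms, while conversely m atoms have m distinct residues, so
-- every class contains an atom, and the atom in the class of x + y shows x + y − m ∈ T.

module Submission where

open import Defs
open import Data.Bool using (Bool; true; false; _∨_; _∧_)
open import Data.Bool.Properties using (T-≡; ∨-zeroʳ; ∨-identityʳ)
import Data.Bool.Properties as Bool
open import Data.Fin as Fin using (Fin; toℕ; punchOut)
open import Data.Fin.Properties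
  using (toℕ-fromℕ<; toℕ-injective; toℕ<n; fromℕ<-cong; punchOut-injective; injective⇒≤)
open import Data.List using (List; lookup; tabulate)
open import Data.List.Properties using (length-tabulate)
import Data.List.Relation.Unary.All as All
open import Data.List.Relation.Unary.AllPairs using (_∷_)
open import Data.List.Relation.Unary.Unique.Propositional using (Unique)
open import Data.List.Relation.Unary.Unique.Propositional.Properties using (tabulate⁺)
open import Data.List.Membership.Propositional using (_∈_)
open import Data.List.Membership.Propositional.Properties using (∈-tabulate⁺; ∈-tabulate⁻; ∈-lookup)
open import Data.Maybe using (just; nothing; fromMaybe)
open import Data.Nat
open import Data.Nat.DivMod
open import Data.Nat.Properties
open import Data.Nat.Tactic.RingSolver using (solve-∀)
open import Data.Product using (_×_; _,_; proj₁; proj₂; ∃-syntax; Σ-syntax)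
open import Data.Sum using (_⊎_; inj₁; inj₂)
open import Function.Base using (_∘_)
open import Function.Bundles using (_⇔_; mk⇔; Equivalence)
open import Function.Definitions using (Injective)
open import Function.Properties.Equivalence using () renaming (trans to ⇔-trans; sym to ⇔-sym)
open import Relation.Binary.PropositionalEquality
open import Relation.Nullary using (¬_; Dec; yes; no)
open import Relation.Nullary.Decidable using (_×-dec_)
open import Relation.Nullary.Negation using (contradiction)

true≢false : true ≢ false
true≢false ()

Minimal : (ℕ → Set) → ℕ → Set
Minimal P k = P k × (∀ j → j < k → ¬ P j)

module _ {P : ℕ → Set} (P? : ∀ n → Dec (P n)) where

  minimal-below : ∀ n → (∀ j → j < n → ¬ P j) ⊎ ∃[ k ] Minimal P k
  minimal-below zero = inj₁ λ _ ()
  minimal-below (suc n) with minimal-below n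
  ... | inj₂ found = inj₂ found
  ... | inj₁ none with P? n
  ...   | yes pn = inj₂ (n , pn , none)
  ...   | no ¬pn = inj₁ below
    where
    below : ∀ j → j < suc n → ¬ P j
    below j j<1+n with m<1+n⇒m<n∨m≡n j<1+n
    ... | inj₁ j<n = none j j<n
    ... | inj₂ refl = ¬pn

  minimal : ∀ {n} → P n → ∃[ k ] Minimal P k
  minimal {n} pn with minimal-below (suc n)
  ... | inj₁ none = contradiction pn (none n (n<1+n n))
  ... | inj₂ found = found

injective-missing⇒< : ∀ {k n} (f : Fin k → Fin n) → Injective _≡_ _≡_ f →
  (r : Fin n) → (∀ i → f i ≢ r) → k < n
injective-missing⇒< {n = suc n} f f-inj r r∉f = s≤s (injective⇒≤ punched-injective)
  where
  punched-injective : Injective _≡_ _≡_ (λ i → punchOut (r∉f i ∘ sym))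
  punched-injective {i} {j} eq = f-inj (punchOut-injective (r∉f i ∘ sym) (r∉f j ∘ sym) eq)

lookup-injective : ∀ {A : Set} {xs : List A} → Unique xs → Injective _≡_ _≡_ (lookup xs)
lookup-injective (_ ∷ _) {Fin.zero} {Fin.zero} _ = refl
lookup-injective (x∉xs ∷ _) {Fin.zero} {Fin.suc j} eq = contradiction eq (All.lookup x∉xs (∈-lookup j))
lookup-injective (x∉xs ∷ _) {Fin.suc i} {Fin.zero} eq = contradiction (sym eq) (All.lookup x∉xs (∈-lookup i))
lookup-injective (_ ∷ u) {Fin.suc i} {Fin.suc j} eq = cong Fin.suc (lookup-injective u eq)

shifted-sum : ∀ a b m → (a + m) + (b + m) ∸ m ≡ a + b + m
shifted-sum a b m = trans (cong (_∸ m) (rearrange a b m)) (m+n∸n≡m (a + b + m) m)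
  where
  rearrange : ∀ a b m → (a + m) + (b + m) ≡ a + b + m + m
  rearrange = solve-∀

0<n⇒pred[n]<n : ∀ {n} → 0 < n → pred n < n
0<n⇒pred[n]<n {suc n} _ = n<1+n n

m∸[n∸o]≡o+[m∸n] : ∀ {m n o} → o ≤ n → n ≤ m → m ∸ (n ∸ o) ≡ o + (m ∸ n)
m∸[n∸o]≡o+[m∸n] {m} {n} {o} o≤n n≤m = begin
  m ∸ (n ∸ o)                       ≡⟨ cong (_∸ (n ∸ o)) split ⟨
  o + (m ∸ n) + (n ∸ o) ∸ (n ∸ o)   ≡⟨ m+n∸n≡m _ (n ∸ o) ⟩
  o + (m ∸ n)                       ∎
  where
  open ≡-Reasoning
  split : o + (m ∸ n) + (n ∸ o) ≡ m
  split = begin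
    o + (m ∸ n) + (n ∸ o)   ≡⟨ +-assoc o _ _ ⟩
    o + ((m ∸ n) + (n ∸ o)) ≡⟨ cong (o +_) (+-comm (m ∸ n) _) ⟩
    o + ((n ∸ o) + (m ∸ n)) ≡⟨ +-assoc o _ _ ⟨
    o + (n ∸ o) + (m ∸ n)   ≡⟨ cong (_+ (m ∸ n)) (m+[n∸m]≡n o≤n) ⟩
    n + (m ∸ n)             ≡⟨ m+[n∸m]≡n n≤m ⟩
    m                       ∎

≤ᵇ-true : ∀ {m n} → m ≤ n → (m ≤ᵇ n) ≡ true
≤ᵇ-true = Equivalence.to T-≡ ∘ ≤⇒≤ᵇ

≤ᵇ-true⁻¹ : ∀ {m n} → (m ≤ᵇ n) ≡ true → m ≤ n
≤ᵇ-true⁻¹ {m} {n} = ≤ᵇ⇒≤ m n ∘ Equivalence.from T-≡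

≤ᵇ-false : ∀ {m n} → n < m → (m ≤ᵇ n) ≡ false
≤ᵇ-false {m} {n} n<m with m ≤ᵇ n in eq
... | false = refl
... | true = contradiction (≤ᵇ-true⁻¹ eq) (<⇒≱ n<m)

extend-below : ∀ {p : ℕ → Bool} {b n v} → p n ≡ v → (∀ k → b < k → k < n → p k ≡ v) →
  ∀ k → b < k → k < suc n → p k ≡ v
extend-below pn below k b<k k<1+n with m<1+n⇒m<n∨m≡n k<1+n
... | inj₁ k<n = below k b<k k<n
... | inj₂ refl = pn

vacuous-above : ∀ {p : ℕ → Bool} {n v} → ∀ k → n < k → k < suc n → p k ≡ v
vacuous-above k n<k k<1+n = contradiction (s≤s⁻¹ k<1+n) (<⇒≱ n<k)

lastFalseBelow-nothing : ∀ p n → lastFalseBelow p n ≡ nothing → ∀ k → k < n → p k ≡ true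
lastFalseBelow-nothing p (suc n) e k k<1+n with p n in pn
... | true with m<1+n⇒m<n∨m≡n k<1+n
...   | inj₁ k<n = lastFalseBelow-nothing p n e k k<n
...   | inj₂ refl = pn

lastFalseBelow-just : ∀ p n {f} → lastFalseBelow p n ≡ just f →
  f < n × p f ≡ false × (∀ k → f < k → k < n → p k ≡ true)
lastFalseBelow-just p (suc n) e with p n in pn
... | true = let (f<n , pf , above) = lastFalseBelow-just p n e
             in m<n⇒m<1+n f<n , pf , extend-below {p = p} pn above
lastFalseBelow-just p (suc n) refl | false = n<1+n n , pn , vacuous-above {p = p}

lastTrueBelow-spec : ∀ p f → p 0 ≡ true → 0 < f → let b = fromMaybe 0 (lastTrueBelow p f) in
  b < f × p b ≡ true × (∀ k → b < k → k < f → p k ≡ false)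
lastTrueBelow-spec p (suc zero) p0 _ rewrite p0 = n<1+n 0 , p0 , vacuous-above {p = p}
lastTrueBelow-spec p (suc (suc f)) p0 _ with lastTrueBelow-spec p (suc f) p0 z<s | p (suc f) in e
... | _ | true = n<1+n (suc f) , e , vacuous-above {p = p}
... | b<f , pb , above | false = m<n⇒m<1+n b<f , pb , extend-below {p = p} e above

-- Multiplicity and maximal embedding dimension

IsAdditivelyClosed : CofSet → Set
IsAdditivelyClosed S = ∀ a b → a ∈ₛ S → b ∈ₛ S → (a + b) ∈ₛ S

ClosedUnderShiftedSum : CofSet → ℕ → Set
ClosedUnderShiftedSum T m =
  ∀ x y → 0 < x → 0 < y → x ∈ₛ T → y ∈ₛ T → (x + y ∸ m) ∈ₛ T

multiplicity-≤ : ∀ T {m x} → IsMultiplicity T m → 0 < x → x ∈ₛ T → m ≤ x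
multiplicity-≤ _ (_ , _ , none-below) 0<x x∈T = ≮⇒≥ λ x<m → none-below _ 0<x x<m x∈T

multiplicity-unique : ∀ {T m m′} → IsMultiplicity T m → IsMultiplicity T m′ → m ≡ m′
multiplicity-unique {T} mult@(0<m , m∈T , _) mult′@(0<m′ , m′∈T , _) =
  ≤-antisym (multiplicity-≤ T mult 0<m′ m′∈T) (multiplicity-≤ T mult′ 0<m m∈T)

shifted-+-closed⇔closedUnderShiftedSum : ∀ {S T m} → IsMultiplicity T m →
  (∀ n → mem S n ≡ mem T (n + m)) →
  IsAdditivelyClosed S ⇔ ClosedUnderShiftedSum T m
shifted-+-closed⇔closedUnderShiftedSum {S} {T} {m} mult shift = mk⇔ to from
  where
  unshift : ∀ {x} → 0 < x → x ∈ₛ T → (x ∸ m) ∈ₛ S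
  unshift 0<x x∈T = trans (shift _) (trans (cong (mem T) (m∸n+n≡m (multiplicity-≤ T mult 0<x x∈T))) x∈T)

  to : IsAdditivelyClosed S → ClosedUnderShiftedSum T m
  to +-closed x y 0<x 0<y x∈T y∈T =
    subst (_∈ₛ T) eq (trans (sym (shift _)) (+-closed _ _ (unshift 0<x x∈T) (unshift 0<y y∈T)))
    where
    eq : x ∸ m + (y ∸ m) + m ≡ x + y ∸ m
    eq = trans (sym (shifted-sum (x ∸ m) (y ∸ m) m))
               (cong₂ (λ u v → u + v ∸ m) (m∸n+n≡m (multiplicity-≤ T mult 0<x x∈T))
                                           (m∸n+n≡m (multiplicity-≤ T mult 0<y y∈T)))

  from : ClosedUnderShiftedSum T m → IsAdditivelyClosed S
  from closed a b a∈S b∈S = trans (shift (a + b)) (subst (_∈ₛ T) (shifted-sum a b m)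
    (closed (a + m) (b + m) (shifted-pos a) (shifted-pos b)
      (trans (sym (shift a)) a∈S) (trans (sym (shift b)) b∈S)))
    where
    shifted-pos : ∀ a → 0 < a + m
    shifted-pos a = <-≤-trans (proj₁ mult) (m≤n+m m a)

multiplicity-1 : ∀ T → 1 ∈ₛ T → IsMultiplicity T 1
multiplicity-1 _ 1∈T = z<s , 1∈T , λ k 0<k k<1 _ → <-irrefl refl (<-≤-trans 0<k (s≤s⁻¹ k<1))

module MaximalEmbeddingDimension {T : CofSet} (isNSG : IsNumericalSemigroup T)
  {M : ℕ} (mult : IsMultiplicity T M) where

  private
    instance
      M-nonZero : NonZero M
      M-nonZero = >-nonZero (proj₁ mult)

    0<M = proj₁ mult
    M∈T = proj₁ (proj₂ mult)
    +-closed = proj₂ isNSG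

  residue : ℕ → Fin M
  residue x = x mod M

  residue⇒% : ∀ {x y} → residue x ≡ residue y → x % M ≡ y % M
  residue⇒% eq = trans (sym (toℕ-fromℕ< _)) (trans (cong toℕ eq) (toℕ-fromℕ< _))

  residue-+-* : ∀ x k → residue (x + k * M) ≡ residue x
  residue-+-* x k = fromℕ<-cong _ _ ([m+kn]%n≡m%n x k M) _ _

  residue-+M : ∀ x → residue (x + M) ≡ residue x
  residue-+M x = fromℕ<-cong _ _ ([m+n]%n≡m%n x M) _ _

  residue-toℕ : ∀ r → residue (toℕ r) ≡ r
  residue-toℕ r = toℕ-injective (trans (toℕ-fromℕ< _) (m<n⇒m%n≡m (toℕ<n r)))

  same-residue-< : ∀ {x y} → residue x ≡ residue y → x < y → ∃[ k ] y ≡ x + k * M + M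
  same-residue-< {x} {y} same x<y with x / M <? y / M
  ... | yes qx<qy = k , (begin
    y                             ≡⟨ m≡m%n+[m/n]*n y M ⟩
    y % M + y / M * M             ≡⟨ cong₂ (λ r q → r + q * M) (sym (residue⇒% same)) (sym (m+[n∸m]≡n qx<qy)) ⟩
    x % M + (suc (x / M) + k) * M ≡⟨ expand (x % M) (x / M) k M ⟩
    x % M + x / M * M + k * M + M ≡⟨ cong (λ z → z + k * M + M) (sym (m≡m%n+[m/n]*n x M)) ⟩
    x + k * M + M                 ∎)
    where
    open ≡-Reasoning
    k = y / M ∸ suc (x / M)
    expand : ∀ r q k M → r + (suc q + k) * M ≡ r + q * M + k * M + M
    expand = solve-∀
  ... | no qx≮qy = contradiction x<y (≤⇒≯ (begin
    y                 ≡⟨ m≡m%n+[m/n]*n y M ⟩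
    y % M + y / M * M ≤⟨ +-mono-≤ (≤-reflexive (residue⇒% (sym same))) (*-monoˡ-≤ M (≮⇒≥ qx≮qy)) ⟩
    x % M + x / M * M ≡⟨ m≡m%n+[m/n]*n x M ⟨
    x                 ∎))
    where open ≤-Reasoning

  +-multiples : ∀ {x} → x ∈ₛ T → ∀ k → (x + k * M) ∈ₛ T
  +-multiples {x} x∈T zero = subst (_∈ₛ T) (sym (+-identityʳ x)) x∈T
  +-multiples {x} x∈T (suc k) = subst (_∈ₛ T) (regroup x k M) (+-closed _ _ (+-multiples x∈T k) M∈T)
    where
    regroup : ∀ x k M → x + k * M + M ≡ x + suc k * M
    regroup = solve-∀

  sum-not-atom : ∀ {x y} → 0 < x → 0 < y → x ∈ₛ T → y ∈ₛ T → ¬ IsAtom T (x + y)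
  sum-not-atom 0<x 0<y x∈T y∈T (_ , _ , irreducible) =
    irreducible (_ , _ , 0<x , 0<y , x∈T , y∈T , refl)

  atom-≤ : ∀ {a x} → IsAtom T a → 0 < x → x ∈ₛ T → residue x ≡ residue a → a ≤ x
  atom-≤ {a} {x} a-atom 0<x x∈T same = ≮⇒≥ x≮a
    where
    x≮a : ¬ x < a
    x≮a x<a with same-residue-< same x<a
    ... | k , refl = sum-not-atom (<-≤-trans 0<x (m≤m+n x (k * M))) 0<M (+-multiples x∈T k) M∈T a-atom

  atom-residue-injective : ∀ {a b} → IsAtom T a → IsAtom T b → residue a ≡ residue b → a ≡ b
  atom-residue-injective a-atom@(0<a , a∈T , _) b-atom@(0<b , b∈T , _) same =
    ≤-antisym (atom-≤ a-atom 0<b b∈T (sym same)) (atom-≤ b-atom 0<a a∈T same)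

  atom-in-every-residue : IsMaxEmbeddingDimension T → ∀ r → ¬ (∀ a → IsAtom T a → residue a ≢ r)
  atom-in-every-residue (m′ , mult′ , as , unique , atoms⇔ , |as|≡m′) r missing =
    <-irrefl (trans |as|≡m′ (multiplicity-unique {T} mult′ mult))
      (injective-missing⇒< (residue ∘ lookup as) residue-injective r (λ i → missing _ (atom-at i)))
    where
    atom-at : ∀ i → IsAtom T (lookup as i)
    atom-at i = Equivalence.to (atoms⇔ _) (∈-lookup i)
    residue-injective : Injective _≡_ _≡_ (residue ∘ lookup as)
    residue-injective {i} {j} same = lookup-injective unique (atom-residue-injective (atom-at i) (atom-at j) same)

  isMED⇒closedUnderShiftedSum : IsMaxEmbeddingDimension T → ClosedUnderShiftedSum T M
  isMED⇒closedUnderShiftedSum med x y 0<x 0<y x∈T y∈T with mem T (x + y ∸ M) Bool.≟ true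
  ... | yes z∈T = z∈T
  ... | no z∉T = contradiction no-atom (atom-in-every-residue med (residue (x + y)))
    where
    0<x+y = <-≤-trans 0<x (m≤m+n x y)
    no-atom : ∀ a → IsAtom T a → residue a ≢ residue (x + y)
    no-atom a a-atom@(_ , a∈T , _) same with m≤n⇒m<n∨m≡n (atom-≤ a-atom 0<x+y (+-closed x y x∈T y∈T) (sym same))
    ... | inj₂ refl = sum-not-atom 0<x 0<y x∈T y∈T a-atom
    ... | inj₁ a<x+y with same-residue-< same a<x+y
    ...   | k , x+y≡ = z∉T (subst (_∈ₛ T) (sym (trans (cong (_∸ M) x+y≡) (m+n∸n≡m _ M))) (+-multiples a∈T k))

  module _ (closed : ClosedUnderShiftedSum T M) where

    PositiveInResidue : Fin M → ℕ → Set
    PositiveInResidue r x = 0 < x × x ∈ₛ T × residue x ≡ r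

    positiveInResidue? : ∀ r x → Dec (PositiveInResidue r x)
    positiveInResidue? r x = 0 <? x ×-dec (mem T x Bool.≟ true ×-dec residue x Fin.≟ r)

    residue-class-nonempty : ∀ r → ∃[ x ] PositiveInResidue r x
    residue-class-nonempty r =
      x , <-≤-trans 0<M (≤-trans (m≤m+n M _) x≥) , proj₂ (proj₁ isNSG) x (≤-trans bound≤ x≥)
        , trans (residue-+-* (toℕ r) (suc (bound T))) (residue-toℕ r)
      where
      x = toℕ r + suc (bound T) * M
      x≥ : M + bound T * M ≤ x
      x≥ = m≤n+m _ (toℕ r)
      bound≤ : bound T ≤ M + bound T * M
      bound≤ = ≤-trans (m≤m*n (bound T) M) (m≤n+m _ M)

    -- For r = 0 this is M rather than 0, unlike in the Apéry set.
    apery : Fin M → ℕ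
    apery r = proj₁ (minimal (positiveInResidue? r) (proj₂ (residue-class-nonempty r)))

    apery-minimal : ∀ r → Minimal (PositiveInResidue r) (apery r)
    apery-minimal r = proj₂ (minimal (positiveInResidue? r) (proj₂ (residue-class-nonempty r)))

    residue-apery : ∀ r → residue (apery r) ≡ r
    residue-apery r = proj₂ (proj₂ (proj₁ (apery-minimal r)))

    apery-injective : Injective _≡_ _≡_ apery
    apery-injective {r} {s} eq = trans (sym (residue-apery r)) (trans (cong residue eq) (residue-apery s))

    apery-atom : ∀ r → IsAtom T (apery r)
    apery-atom r with apery-minimal r
    ... | (0<w , w∈T , _) , none-below = 0<w , w∈T , irreducible
      where
      -- a decomposition x + y would make x + y ∸ M a smaller element of the same class
      irreducible : ¬ (∃[ x ] ∃[ y ] (0 < x) × (0 < y) × (x ∈ₛ T) × (y ∈ₛ T) × (x + y ≡ apery r))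
      irreducible (x , y , 0<x , 0<y , x∈T , y∈T , x+y≡w) = none-below (x + y ∸ M)
        (subst (x + y ∸ M <_) x+y≡w (∸-monoʳ-< 0<M M≤x+y))
        (0<z , closed x y 0<x 0<y x∈T y∈T , z-res)
        where
        M≤y = multiplicity-≤ T mult 0<y y∈T
        M≤x+y = ≤-trans M≤y (m≤n+m y x)
        0<z : 0 < x + y ∸ M
        0<z = <-≤-trans 0<x (subst (x ≤_) (sym (+-∸-assoc x M≤y)) (m≤m+n x (y ∸ M)))
        z-res : residue (x + y ∸ M) ≡ r
        z-res = begin
          residue (x + y ∸ M)      ≡⟨ residue-+M (x + y ∸ M) ⟨
          residue (x + y ∸ M + M)  ≡⟨ cong residue (trans (m∸n+n≡m M≤x+y) x+y≡w) ⟩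
          residue (apery r)        ≡⟨ residue-apery r ⟩
          r                        ∎
          where open ≡-Reasoning

    atom≡apery : ∀ {a} → IsAtom T a → a ≡ apery (residue a)
    atom≡apery {a} a-atom@(0<a , a∈T , _) with apery-minimal (residue a)
    ... | (0<w , w∈T , w-res) , none-below =
      ≤-antisym (atom-≤ a-atom 0<w w∈T w-res) (≮⇒≥ λ a<w → none-below a a<w (0<a , a∈T , refl))

    closedUnderShiftedSum⇒isMED : IsMaxEmbeddingDimension T
    closedUnderShiftedSum⇒isMED =
      M , mult , tabulate apery , tabulate⁺ apery-injective , atoms⇔ , length-tabulate apery
      where
      atoms⇔ : ∀ a → a ∈ tabulate apery ⇔ IsAtom T a
      atoms⇔ a = mk⇔
        (λ a∈ → let (r , a≡) = ∈-tabulate⁻ a∈ in subst (IsAtom T) (sym a≡) (apery-atom r))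
        (λ a-atom → subst (_∈ tabulate apery) (sym (atom≡apery a-atom)) (∈-tabulate⁺ (residue a)))

  isMED⇔closedUnderShiftedSum : IsMaxEmbeddingDimension T ⇔ ClosedUnderShiftedSum T M
  isMED⇔closedUnderShiftedSum = mk⇔ isMED⇒closedUnderShiftedSum closedUnderShiftedSum⇒isMED

-- Complements of numerical sets

-- For S ≠ ℕ, complement S unfolds to reflectAt S (baseAt S F) once frobenius S ≡ just F.
reflectAt : CofSet → ℕ → CofSet
reflectAt S b = mkCofSet (λ n → (b ≤ᵇ n) ∨ ((n ≤ᵇ b) ∧ mem S (b ∸ n))) b

unionAbove : CofSet → ℕ → CofSet
unionAbove S b = mkCofSet (λ n → mem S n ∨ (b ≤ᵇ n)) (bound S)

reflectAt-≥ : ∀ S {b n} → b ≤ n → n ∈ₛ reflectAt S b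
reflectAt-≥ _ b≤n rewrite ≤ᵇ-true b≤n = refl

reflectAt-< : ∀ S {b n} → n < b → mem (reflectAt S b) n ≡ mem S (b ∸ n)
reflectAt-< _ n<b rewrite ≤ᵇ-false n<b | ≤ᵇ-true (<⇒≤ n<b) = refl

unionAbove-≥ : ∀ S {b n} → b ≤ n → n ∈ₛ unionAbove S b
unionAbove-≥ S {n = n} b≤n rewrite ≤ᵇ-true b≤n = ∨-zeroʳ (mem S n)

unionAbove-< : ∀ S {b n} → n < b → mem (unionAbove S b) n ≡ mem S n
unionAbove-< S {n = n} n<b rewrite ≤ᵇ-false n<b = ∨-identityʳ (mem S n)

unionAbove-⊇ : ∀ S b {n} → n ∈ₛ S → n ∈ₛ unionAbove S b
unionAbove-⊇ _ _ n∈S rewrite n∈S = refl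

reflectAt-twice : ∀ S {b b′} → b′ < b → ∀ n →
  mem (reflectAt (reflectAt S b) b′) n ≡ mem (unionAbove S b) (n + (b ∸ b′))
reflectAt-twice S {b} {b′} b′<b n with b′ ≤? n
... | yes b′≤n = trans (reflectAt-≥ (reflectAt S b) b′≤n) (sym (unionAbove-≥ S b≤))
  where
  b≤ : b ≤ n + (b ∸ b′)
  b≤ = subst (_≤ n + (b ∸ b′)) (m+[n∸m]≡n (<⇒≤ b′<b)) (+-monoˡ-≤ (b ∸ b′) b′≤n)
... | no b′≰n = begin
  mem (reflectAt (reflectAt S b) b′) n ≡⟨ reflectAt-< (reflectAt S b) n<b′ ⟩
  mem (reflectAt S b) (b′ ∸ n)         ≡⟨ reflectAt-< S (≤-<-trans (m∸n≤m b′ n) b′<b) ⟩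
  mem S (b ∸ (b′ ∸ n))                 ≡⟨ cong (mem S) (m∸[n∸o]≡o+[m∸n] (<⇒≤ n<b′) (<⇒≤ b′<b)) ⟩
  mem S (n + (b ∸ b′))                 ≡⟨ unionAbove-< S <b ⟨
  mem (unionAbove S b) (n + (b ∸ b′))  ∎
  where
  open ≡-Reasoning
  n<b′ = ≰⇒> b′≰n
  <b : n + (b ∸ b′) < b
  <b = subst (n + (b ∸ b′) <_) (m+[n∸m]≡n (<⇒≤ b′<b)) (+-monoˡ-< (b ∸ b′) n<b′)

frobenius-just : ∀ S → IsNumericalSet S → ¬ IsAllℕ S → ∃[ F ] frobenius S ≡ just F
frobenius-just S (_ , cofinite) S≢ℕ with frobenius S in e
... | just F = F , refl
... | nothing = contradiction all-in S≢ℕ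
  where
  all-in : IsAllℕ S
  all-in n with n <? bound S
  ... | yes n<bound = lastFalseBelow-nothing (mem S) (bound S) e n n<bound
  ... | no n≮bound = cofinite n (≮⇒≥ n≮bound)

complement-cofinite : ∀ S → (∀ n → bound S ≤ n → n ∈ₛ S) →
  ∀ n → bound (complement S) ≤ n → n ∈ₛ complement S
complement-cofinite S cofinite n with frobenius S in e
... | nothing = cofinite n
... | just _ = reflectAt-≥ S

baseAt-spec : ∀ S {F} → 0 ∈ₛ S → frobenius S ≡ just F →
  baseAt S F < F × baseAt S F ∈ₛ S × (∀ k → baseAt S F < k → k < F → mem S k ≡ false)
baseAt-spec S {F} 0∈S eF = lastTrueBelow-spec (mem S) F 0∈S 0<F
  where
  F∉S = proj₁ (proj₂ (lastFalseBelow-just (mem S) (bound S) eF))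
  0<F : 0 < F
  0<F = n≢0⇒n>0 λ { refl → true≢false (trans (sym 0∈S) F∉S) }

1-gap : ∀ {S} → IsNumericalSemigroup S → ¬ IsAllℕ S → mem S 1 ≡ false
1-gap {S} ((0∈S , _) , +-closed) S≢ℕ with mem S 1 in e
... | false = refl
... | true = contradiction all-in S≢ℕ
  where
  all-in : IsAllℕ S
  all-in zero = 0∈S
  all-in (suc n) = +-closed 1 n e (all-in n)

unionAbove-isNumericalSemigroup : ∀ {S} b → IsNumericalSemigroup S → IsNumericalSemigroup (unionAbove S b)
unionAbove-isNumericalSemigroup {S} b ((0∈S , cofinite) , +-closed) =
  (unionAbove-⊇ S b 0∈S , λ n bound≤n → unionAbove-⊇ S b (cofinite n bound≤n)) , closed
  where
  closed : IsAdditivelyClosed (unionAbove S b)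
  closed x y x∈T y∈T with mem S x in ex | mem S y in ey
  ... | true  | true  = unionAbove-⊇ S b (+-closed x y ex ey)
  ... | false | _     = unionAbove-≥ S {b} (≤-trans (≤ᵇ-true⁻¹ {b} x∈T) (m≤m+n x y))
  ... | true  | false = unionAbove-≥ S {b} (≤-trans (≤ᵇ-true⁻¹ {b} y∈T) (m≤n+m y x))

reflectAt-pred-∉ : ∀ S {b} → 0 < b → mem S 1 ≡ false → mem (reflectAt S b) (pred b) ≡ false
reflectAt-pred-∉ S {suc c} _ 1∉S = trans (reflectAt-< S (n<1+n c)) (trans (cong (mem S) (m+n∸n≡m 1 c)) 1∉S)

reflectAt-full⇒0 : ∀ S b → mem S 1 ≡ false → (∀ k → k < b → k ∈ₛ reflectAt S b) → b ≡ 0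
reflectAt-full⇒0 S zero _ _ = refl
reflectAt-full⇒0 S (suc b) 1∉S full =
  contradiction (trans (sym (full b (n<1+n b))) (reflectAt-pred-∉ S {suc b} z<s 1∉S)) true≢false

unionAbove-multiplicity : ∀ S {B B′} → B′ < B → B′ ∈ₛ reflectAt S B →
  (∀ j → B′ < j → j < B → mem (reflectAt S B) j ≡ false) → IsMultiplicity (unionAbove S B) (B ∸ B′)
unionAbove-multiplicity S {B} {B′} B′<B B′∈C gaps =
  m<n⇒0<n∸m B′<B , unionAbove-⊇ S B (trans (sym (reflectAt-< S B′<B)) B′∈C) , none-below
  where
  none-below : ∀ k → 0 < k → k < B ∸ B′ → ¬ k ∈ₛ unionAbove S B
  none-below k 0<k k<B∸B′ k∈T = true≢false (trans (sym k∈T) (begin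
    mem (unionAbove S B) k   ≡⟨ unionAbove-< S k<B ⟩
    mem S k                  ≡⟨ cong (mem S) (m∸[m∸n]≡n (<⇒≤ k<B)) ⟨
    mem S (B ∸ (B ∸ k))      ≡⟨ reflectAt-< S (∸-monoʳ-< 0<k (<⇒≤ k<B)) ⟨
    mem (reflectAt S B) (B ∸ k) ≡⟨ gaps (B ∸ k) B′<B∸k (∸-monoʳ-< 0<k (<⇒≤ k<B)) ⟩
    false                    ∎))
    where
    open ≡-Reasoning
    k<B = <-≤-trans k<B∸B′ (m∸n≤m B B′)
    B′<B∸k : B′ < B ∸ k
    B′<B∸k = m+n≤o⇒m≤o∸n (suc B′)
      (subst (_≤ B) (cong suc (+-comm k B′)) (m≤o∸n⇒m+n≤o (suc k) (<⇒≤ B′<B) k<B∸B′))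

complement-reflectAt-shift : ∀ {S B} → B ∈ₛ S → mem S 1 ≡ false →
  Σ[ m ∈ ℕ ] IsMultiplicity (unionAbove S B) m ×
             (∀ n → mem (complement (reflectAt S B)) n ≡ mem (unionAbove S B) (n + m))
complement-reflectAt-shift {S} {B} B∈S 1∉S with frobenius (reflectAt S B) in eF′
... | nothing = 1 , multiplicity-1 (unionAbove S B) (unionAbove-≥ S (B≤ 1)) ,
                λ n → trans (reflectAt-≥ S (B≤ n)) (sym (unionAbove-≥ S (B≤ (n + 1))))
  where
  B≤ : ∀ n → B ≤ n
  B≤ n = subst (_≤ n) (sym (reflectAt-full⇒0 S B 1∉S (lastFalseBelow-nothing _ B eF′))) z≤n
... | just F′
  with F′<B , F′∉C , above-F′ ← lastFalseBelow-just (mem (reflectAt S B)) B eF′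
  with B′<F′ , B′∈C , gaps-below-F′ ← baseAt-spec (reflectAt S B) (trans (reflectAt-< S (<-≤-trans z<s F′<B)) B∈S) eF′
  = B ∸ B′ , unionAbove-multiplicity S B′<B B′∈C gaps , reflectAt-twice S B′<B
  where
  B′ = baseAt (reflectAt S B) F′
  B′<B = <-trans B′<F′ F′<B
  0<B = <-≤-trans z<s F′<B
  -- pred B is a gap of the reflection because 1 is a gap of S, so F′ = pred B
  pred[B]≤F′ : pred B ≤ F′
  pred[B]≤F′ = ≮⇒≥ λ F′<pred[B] → true≢false (trans
    (sym (above-F′ (pred B) F′<pred[B] (0<n⇒pred[n]<n 0<B)))
    (reflectAt-pred-∉ S 0<B 1∉S))
  gaps : ∀ j → B′ < j → j < B → mem (reflectAt S B) j ≡ false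
  gaps j B′<j j<B with m≤n⇒m<n∨m≡n (≤-trans (<⇒≤pred j<B) pred[B]≤F′)
  ... | inj₁ j<F′ = gaps-below-F′ j B′<j j<F′
  ... | inj₂ refl = F′∉C

secondComplement-shift : ∀ S → IsNumericalSemigroup S → ¬ IsAllℕ S →
  Σ[ m ∈ ℕ ] IsMultiplicity (unionAboveBase S) m ×
             (∀ n → mem (secondComplement S) n ≡ mem (unionAboveBase S) (n + m))
secondComplement-shift S isNSG S≢ℕ with frobenius S in eF | frobenius-just S (proj₁ isNSG) S≢ℕ
... | nothing | _ , ()
... | just F | _ = complement-reflectAt-shift {S} {baseAt S F} B∈S (1-gap isNSG S≢ℕ)
  where
  B∈S = proj₁ (proj₂ (baseAt-spec S (proj₁ (proj₁ isNSG)) eF))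

proposition5p5 : (S : CofSet) → IsNumericalSemigroup S → ¬ IsAllℕ S →
    IsNumericalSemigroup (secondComplement S) ⇔ IsMaxEmbeddingDimension (unionAboveBase S)
proposition5p5 S isNSG S≢ℕ with secondComplement-shift S isNSG S≢ℕ
... | m , mult , shift =
  ⇔-trans (mk⇔ proj₂ (isNumericalSet ,_))
    (⇔-trans (shifted-+-closed⇔closedUnderShiftedSum {secondComplement S} {unionAboveBase S} mult shift)
             (⇔-sym isMED⇔closedUnderShiftedSum))
  where
  open MaximalEmbeddingDimension (unionAbove-isNumericalSemigroup (base S) isNSG) mult
  isNumericalSet : IsNumericalSet (secondComplement S)
  isNumericalSet = trans (shift 0) (proj₁ (proj₂ mult))
                 , complement-cofinite (complement S) (complement-cofinite S (proj₂ (proj₁ isNSG)))
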